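{- Let $\mathbf M$ be a cyclic pointed residuated $\mathbf S$-bimodule with point $0$. On the Nagata product $\mathbf S\ltimes\mathbf M$, with the pre-conucleus $\sigma\langle a,x\rangle=\langle a,a*0\rangle$, the map $\gamma\langle a,x\rangle=\langle 0\backslash_r x,x\rangle$ is a $\sigma$-structural $\sigma$-closure operator; hence the same holds for the restrictions of $\sigma$ and $\gamma$ to the restricted Nagata product $(\mathbf S\ltimes\mathbf M)_0$.
   Context: $\mathbf S$ is a posemigroup (poset with isotone associative multiplication), $\mathbf M=\langle M,\vee\rangle$ a join semilattice; elements of $S$ are $a,b$, of $M$ are $x,y$. A residuated $\mathbf S$-bimodule: isotone actions $a*x,x*a\in M$ with $(ab)*x=a*(b*x)$, $x*(ab)=(x*a)*b$, $(a*x)*b=a*(x*b)$, distributing over $\vee$, and maps $\backslash_\ell:S\times M\to M$, $/_\ell:M\times M\to S$, $\backslash_r:M\times M\to S$, $/_r:M\times S\to M$ with $x\le a\backslash_\ell y\iff a*x\le y\iff a\le y/_\ell x$ and $x\le y/_r a\iff x*a\le y\iff a\le x\backslash_r y$. Cyclic pointed: $0\in M$ with $a*0=0*a$ for all $a$. The Nagata product $\mathbf S\ltimes\mathbf M$: $S\times M$ with componentwise order and $\langle a,x\rangle\circ\langle b,y\rangle=\langle ab,x*b\vee a*y\rangle$; the restricted Nagata product is its subposemigroup on $\{\langle a,x\rangle:0*a\le x,a*0\le x\}$. For an idempotent isotone map $\gamma$ on a posemigroup $\mathbf N$ write $N_\gamma=\gamma[N]$. A pre-conucleus is an idempotent isotone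 $\sigma$ with $N_\sigma$ a subsemigroup. A $\sigma$-closure operator is an idempotent isotone $\gamma$ with $a\cdot x\le\gamma(a\cdot x)$ and $x\cdot a\le\gamma(x\cdot a)$ for $a\in N_\sigma$, $x\in N_\gamma$; it is $\sigma$-structural if $a\cdot\gamma m\le\gamma(a\cdot m)$ and $\gamma m\cdot a\le\gamma(m\cdot a)$ for $a\in N_\sigma$, $m\in N$. -}

module Defs where

open import Level using (Level; _⊔_; suc)
open import Data.Product using (Σ; _×_; _,_; proj₁; proj₂)
open import Relation.Binary.Core using (Rel)
open import Relation.Binary.Structures using (IsPartialOrder)
open import Relation.Binary.Lattice.Structures using (IsJoinSemilattice)
open import Relation.Binary.PropositionalEquality using (_≡_; refl)
open import Function.Bundles using (_⇔_; Equivalence)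
open import Relation.Binary.PropositionalEquality using (cong₂; sym; trans; subst)
import Relation.Binary.Lattice.Properties.JoinSemilattice as JSLProps
open import Relation.Binary.Bundles using (Poset)
open import Relation.Binary.Lattice.Bundles using (JoinSemilattice)

-- Equality is a setoid equality _≈_ (needed for subposemigroups whose
-- carriers are Σ-types; for S, M and the Nagata product it is _≡_).

record Posemigroup (c ℓ₁ ℓ₂ : Level) : Set (suc (c ⊔ ℓ₁ ⊔ ℓ₂)) where
  infix 4 _≈_ _≤_
  infixl 7 _·_
  field
    Carrier        : Set c
    _≈_            : Rel Carrier ℓ₁
    _≤_            : Rel Carrier ℓ₂
    _·_            : Carrier → Carrier → Carrier
    isPartialOrder : IsPartialOrder _≈_ _≤_
    assoc          : ∀ a b c → (a · b) · c ≈ a · (b · c)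
    ·-mono         : ∀ {a a′ b b′} → a ≤ a′ → b ≤ b′ → a · b ≤ a′ · b′

module _ {c ℓ₁ ℓ₂} (N : Posemigroup c ℓ₁ ℓ₂) where
  open Posemigroup N

  InImage : (Carrier → Carrier) → Carrier → Set (c ⊔ ℓ₁)
  InImage γ x = Σ Carrier (λ m → x ≈ γ m)

  IsIdempotentIsotone : (Carrier → Carrier) → Set (c ⊔ ℓ₁ ⊔ ℓ₂)
  IsIdempotentIsotone γ =
    (∀ m → γ (γ m) ≈ γ m) × (∀ {m n} → m ≤ n → γ m ≤ γ n)

  IsPreConucleus : (Carrier → Carrier) → Set (c ⊔ ℓ₁ ⊔ ℓ₂)
  IsPreConucleus σ =
    IsIdempotentIsotone σ ×
    (∀ x y → InImage σ x → InImage σ y → InImage σ (x · y))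

  IsσClosure : (σ γ : Carrier → Carrier) → Set (c ⊔ ℓ₁ ⊔ ℓ₂)
  IsσClosure σ γ =
    IsIdempotentIsotone γ ×
    (∀ a x → InImage σ a → InImage γ x →
       (a · x ≤ γ (a · x)) × (x · a ≤ γ (x · a)))

  IsσStructural : (σ γ : Carrier → Carrier) → Set (c ⊔ ℓ₁ ⊔ ℓ₂)
  IsσStructural σ γ =
    ∀ a m → InImage σ a →
      (a · γ m ≤ γ (a · m)) × (γ m · a ≤ γ (m · a))

  IsσStructuralσClosure : (σ γ : Carrier → Carrier) → Set (c ⊔ ℓ₁ ⊔ ℓ₂)
  IsσStructuralσClosure σ γ = IsσClosure σ γ × IsσStructural σ γ

record ResiduatedBimodule (c ℓ : Level) : Set (suc (c ⊔ ℓ)) where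
  infix 4 _≤S_ _≤M_
  infixl 7 _·_
  infixr 6 _∨_
  infixr 7 _*ˡ_
  infixl 7 _*ʳ_
  field
    S     : Set c
    _≤S_  : Rel S ℓ
    _·_   : S → S → S
    S-po  : IsPartialOrder _≡_ _≤S_
    ·-assoc : ∀ a b c → (a · b) · c ≡ a · (b · c)
    ·-mono  : ∀ {a a′ b b′} → a ≤S a′ → b ≤S b′ → a · b ≤S a′ · b′
    M     : Set c
    _≤M_  : Rel M ℓ
    _∨_   : M → M → M
    M-jsl : IsJoinSemilattice _≡_ _≤M_ _∨_
    _*ˡ_  : S → M → M
    _*ʳ_  : M → S → M
    *ˡ-mono : ∀ {a b x y} → a ≤S b → x ≤M y → a *ˡ x ≤M b *ˡ y
    *ʳ-mono : ∀ {a b x y} → a ≤S b → x ≤M y → x *ʳ a ≤M y *ʳ b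
    *ˡ-assoc : ∀ a b x → (a · b) *ˡ x ≡ a *ˡ (b *ˡ x)
    *ʳ-assoc : ∀ x a b → x *ʳ (a · b) ≡ (x *ʳ a) *ʳ b
    *-bi     : ∀ a x b → (a *ˡ x) *ʳ b ≡ a *ˡ (x *ʳ b)
    *ˡ-∨     : ∀ a x y → a *ˡ (x ∨ y) ≡ (a *ˡ x) ∨ (a *ˡ y)
    *ʳ-∨     : ∀ x y a → (x ∨ y) *ʳ a ≡ (x *ʳ a) ∨ (y *ʳ a)
    _∖ˡ_ : S → M → M
    _/ˡ_ : M → M → S
    _∖ʳ_ : M → M → S
    _/ʳ_ : M → S → M
    resˡ₁ : ∀ a x y → (x ≤M a ∖ˡ y) ⇔ (a *ˡ x ≤M y)
    resˡ₂ : ∀ a x y → (a *ˡ x ≤M y) ⇔ (a ≤S y /ˡ x)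
    resʳ₁ : ∀ a x y → (x ≤M y /ʳ a) ⇔ (x *ʳ a ≤M y)
    resʳ₂ : ∀ a x y → (x *ʳ a ≤M y) ⇔ (a ≤S x ∖ʳ y)

IsCyclicPoint : ∀ {c ℓ} (B : ResiduatedBimodule c ℓ) → ResiduatedBimodule.M B → Set c
IsCyclicPoint B o = ∀ a → a *ˡ o ≡ o *ʳ a
  where open ResiduatedBimodule B

module Nagata {c ℓ} (B : ResiduatedBimodule c ℓ) (o : ResiduatedBimodule.M B) where
  open ResiduatedBimodule B
  private
    module SP = IsPartialOrder S-po
    module MJ = IsJoinSemilattice M-jsl
    JSL : JoinSemilattice c c ℓ
    JSL = record { isJoinSemilattice = M-jsl }
    open JSLProps JSL using (∨-assoc)

  _≤N_ : Rel (S × M) ℓ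
  (a , x) ≤N (b , y) = (a ≤S b) × (x ≤M y)

  _∘N_ : S × M → S × M → S × M
  (a , x) ∘N (b , y) = (a · b , (x *ʳ b) ∨ (a *ˡ y))

  private
    N-po : IsPartialOrder _≡_ _≤N_
    N-po = record
      { isPreorder = record
        { isEquivalence = Relation.Binary.PropositionalEquality.isEquivalence
        ; reflexive = λ { refl → SP.refl , MJ.refl }
        ; trans = λ { (p , q) (p′ , q′) → SP.trans p p′ , MJ.trans q q′ } }
      ; antisym = λ { (p , q) (p′ , q′) → cong₂ _,_ (SP.antisym p p′) (MJ.antisym q q′) } }

    N-assoc : ∀ p q r → (p ∘N q) ∘N r ≡ p ∘N (q ∘N r)
    N-assoc (a , x) (b , y) (d , z) = cong₂ _,_ (·-assoc a b d) eq
      where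
      eq : ((x *ʳ b) ∨ (a *ˡ y)) *ʳ d ∨ (a · b) *ˡ z
         ≡ x *ʳ (b · d) ∨ a *ˡ ((y *ʳ d) ∨ (b *ˡ z))
      eq = trans (cong₂ _∨_ (*ʳ-∨ (x *ʳ b) (a *ˡ y) d) (*ˡ-assoc a b z))
           (trans (∨-assoc _ _ _)
           (cong₂ _∨_ (sym (*ʳ-assoc x b d))
             (trans (cong₂ _∨_ (*-bi a y d) refl) (sym (*ˡ-∨ a (y *ʳ d) (b *ˡ z))))))

    N-mono : ∀ {p p′ q q′} → p ≤N p′ → q ≤N q′ → (p ∘N q) ≤N (p′ ∘N q′)
    N-mono (a≤ , x≤) (b≤ , y≤) =
      ·-mono a≤ b≤ ,
      MJ.∨-least (MJ.trans (*ʳ-mono b≤ x≤) (MJ.x≤x∨y _ _))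
                 (MJ.trans (*ˡ-mono a≤ y≤) (MJ.y≤x∨y _ _))

  NagataProduct : Posemigroup c c ℓ
  NagataProduct = record
    { Carrier = S × M ; _≈_ = _≡_ ; _≤_ = _≤N_ ; _·_ = _∘N_
    ; isPartialOrder = N-po ; assoc = N-assoc ; ·-mono = N-mono }

  σ : S × M → S × M
  σ (a , x) = (a , a *ˡ o)

  γ : S × M → S × M
  γ (a , x) = (o ∖ʳ x , x)

  InR : S × M → Set ℓ
  InR (a , x) = (o *ʳ a ≤M x) × (a *ˡ o ≤M x)

  R : Set (c ⊔ ℓ)
  R = Σ (S × M) InR

  private
    ∘N-closed : ∀ p q → InR p → InR q → InR (p ∘N q)
    ∘N-closed (a , x) (b , y) (p₁ , p₂) (q₁ , q₂) =
      subst (_≤M (x *ʳ b) ∨ (a *ˡ y)) (sym (*ʳ-assoc o a b))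
        (MJ.trans (*ʳ-mono SP.refl p₁) (MJ.x≤x∨y _ _)) ,
      subst (_≤M (x *ʳ b) ∨ (a *ˡ y)) (sym (*ˡ-assoc a b o))
        (MJ.trans (*ˡ-mono SP.refl q₂) (MJ.y≤x∨y _ _))

  _∘R_ : R → R → R
  (p , hp) ∘R (q , hq) = (p ∘N q) , ∘N-closed p q hp hq

  RestrictedNagataProduct : Posemigroup (c ⊔ ℓ) c ℓ
  RestrictedNagataProduct = record
    { Carrier = R
    ; _≈_ = λ p q → proj₁ p ≡ proj₁ q
    ; _≤_ = λ p q → proj₁ p ≤N proj₁ q
    ; _·_ = _∘R_
    ; isPartialOrder = record
      { isPreorder = record
        { isEquivalence = record { refl = refl ; sym = sym ; trans = trans }
        ; reflexive = λ { refl → SP.refl , MJ.refl }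
        ; trans = λ { (p , q) (p′ , q′) → SP.trans p p′ , MJ.trans q q′ } }
      ; antisym = λ { (p , q) (p′ , q′) → cong₂ _,_ (SP.antisym p p′) (MJ.antisym q q′) } }
    ; assoc = λ p q r → N-assoc (proj₁ p) (proj₁ q) (proj₁ r)
    ; ·-mono = N-mono }

  σ-closed : IsCyclicPoint B o → ∀ p → InR (σ p)
  σ-closed cyc (a , x) = subst (_≤M a *ˡ o) (cyc a) MJ.refl , MJ.refl

  γ-closed : IsCyclicPoint B o → ∀ p → InR (γ p)
  γ-closed cyc (a , x) = g , subst (_≤M x) (sym (cyc (o ∖ʳ x))) g
    where g = Equivalence.from (resʳ₂ (o ∖ʳ x) o x) SP.refl

  σ₀ : IsCyclicPoint B o → R → R
  σ₀ cyc (p , _) = σ p , σ-closed cyc p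

  γ₀ : IsCyclicPoint B o → R → R
  γ₀ cyc (p , _) = γ p , γ-closed cyc p

{-# OPTIONS --safe #-}

-- The σ-fixed elements of S ⋉ M are the pairs ⟨b, b * 0⟩, and cyclicity lets such a pair
-- move the point across a product: 0 * (b w) = (b * 0) * w and w * (b * 0) = (w * 0) * b.
-- Together with the counit 0 * (0 \ᵣ y) ≤ y this gives σ-structurality of γ, since
-- ⟨a, x⟩ ≤ γ⟨b, y⟩ just means 0 * a ≤ y and x ≤ y.  A σ-structural γ is automatically a
-- σ-closure operator, because the elements of N_γ are γ-fixed.  Finally, the restricted
-- product embeds into S ⋉ M by an order-embedding homomorphism that commutes with σ and γ,
-- and all these properties pull back along such embeddings.

module Submission where

open import Defs
open import Level using (Level; _⊔_)
open import Data.Product using (_×_; _,_; proj₁; proj₂)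
open import Function.Bundles using (Equivalence)
open import Relation.Binary.Bundles using (Poset)
open import Relation.Binary.Structures using (IsPartialOrder)
open import Relation.Binary.Lattice.Structures using (IsJoinSemilattice)
open import Relation.Binary.Lattice.Bundles using (JoinSemilattice)
open import Relation.Binary.PropositionalEquality as ≡ using (cong)
import Relation.Binary.Lattice.Properties.JoinSemilattice as JoinSemilatticeProperties
import Relation.Binary.Reasoning.PartialOrder as PartialOrderReasoning

module PosemigroupProperties {c ℓ₁ ℓ₂} (N : Posemigroup c ℓ₁ ℓ₂) where
  open Posemigroup N
  open IsPartialOrder isPartialOrder
    using (antisym; reflexive; module Eq) renaming (refl to ≤-refl; trans to ≤-trans)

  poset : Poset c ℓ₁ ℓ₂
  poset = record { isPartialOrder = isPartialOrder }

  isotone-cong : ∀ {γ : Carrier → Carrier} → (∀ {m n} → m ≤ n → γ m ≤ γ n) →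
                 ∀ {m n} → m ≈ n → γ m ≈ γ n
  isotone-cong γ-mono m≈n = antisym (γ-mono (reflexive m≈n)) (γ-mono (reflexive (Eq.sym m≈n)))

  inImage⇒fixed : ∀ {γ x} → IsIdempotentIsotone N γ → InImage N γ x → x ≈ γ x
  inImage⇒fixed {γ} {x} (γ-idem , γ-mono) (m , x≈γm) = begin-equality
    x         ≈⟨ x≈γm ⟩
    γ m       ≈⟨ γ-idem m ⟨
    γ (γ m)   ≈⟨ isotone-cong γ-mono x≈γm ⟨
    γ x       ∎
    where open PartialOrderReasoning poset

  σStructural⇒σClosure : ∀ {σ γ} → IsIdempotentIsotone N γ → IsσStructural N σ γ →
                          IsσClosure N σ γ
  σStructural⇒σClosure γ-ii structural = γ-ii , λ a x a∈Nσ x∈Nγ →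
    let x≤γx = reflexive (inImage⇒fixed γ-ii x∈Nγ)
        (left , right) = structural a x a∈Nσ
    in ≤-trans (·-mono ≤-refl x≤γx) left , ≤-trans (·-mono x≤γx ≤-refl) right

module _ {c ℓ₁ ℓ₂ c′ ℓ₁′ ℓ₂′} (P : Posemigroup c′ ℓ₁′ ℓ₂′) (N : Posemigroup c ℓ₁ ℓ₂) where
  private
    module P = Posemigroup P
    module N = Posemigroup N

  record IsOrderEmbeddingHomomorphism (ι : P.Carrier → N.Carrier)
         : Set (c′ ⊔ ℓ₁ ⊔ ℓ₂ ⊔ ℓ₂′) where
    field
      homo     : ∀ p q → ι (p P.· q) N.≈ ι p N.· ι q
      mono     : ∀ {p q} → p P.≤ q → ι p N.≤ ι q
      reflects : ∀ {p q} → ι p N.≤ ι q → p P.≤ q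

module Restriction
  {c ℓ₁ ℓ₂ c′ ℓ₁′ ℓ₂′} {P : Posemigroup c′ ℓ₁′ ℓ₂′} {N : Posemigroup c ℓ₁ ℓ₂}
  {ι : Posemigroup.Carrier P → Posemigroup.Carrier N}
  (ι-embedding : IsOrderEmbeddingHomomorphism P N ι)
  where
  private
    module P = Posemigroup P
    module N = Posemigroup N
    module P≤ = IsPartialOrder P.isPartialOrder
    module N≤ = IsPartialOrder N.isPartialOrder
    open PosemigroupProperties N using (poset; isotone-cong; inImage⇒fixed)
    open IsOrderEmbeddingHomomorphism ι-embedding
    open PartialOrderReasoning poset

  Restricts : (P.Carrier → P.Carrier) → (N.Carrier → N.Carrier) → Set (c′ ⊔ ℓ₁)
  Restricts γ′ γ = ∀ p → ι (γ′ p) N.≈ γ (ι p)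

  ι-cong : ∀ {p q} → p P.≈ q → ι p N.≈ ι q
  ι-cong p≈q = N≤.antisym (mono (P≤.reflexive p≈q)) (mono (P≤.reflexive (P≤.Eq.sym p≈q)))

  reflects-≈ : ∀ {p q} → ι p N.≈ ι q → p P.≈ q
  reflects-≈ ιp≈ιq =
    P≤.antisym (reflects (N≤.reflexive ιp≈ιq)) (reflects (N≤.reflexive (N≤.Eq.sym ιp≈ιq)))

  restrict-idempotentIsotone : ∀ {γ′ γ} → Restricts γ′ γ →
    IsIdempotentIsotone N γ → IsIdempotentIsotone P γ′
  restrict-idempotentIsotone {γ′} {γ} γ′↾γ (γ-idem , γ-mono) = idem , isotone
    where
    idem : ∀ p → γ′ (γ′ p) P.≈ γ′ p
    idem p = reflects-≈ (begin-equality
      ι (γ′ (γ′ p))  ≈⟨ γ′↾γ (γ′ p) ⟩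
      γ (ι (γ′ p))   ≈⟨ isotone-cong γ-mono (γ′↾γ p) ⟩
      γ (γ (ι p))    ≈⟨ γ-idem (ι p) ⟩
      γ (ι p)        ≈⟨ γ′↾γ p ⟨
      ι (γ′ p)       ∎)

    isotone : ∀ {p q} → p P.≤ q → γ′ p P.≤ γ′ q
    isotone {p} {q} p≤q = reflects (begin
      ι (γ′ p)  ≈⟨ γ′↾γ p ⟩
      γ (ι p)   ≤⟨ γ-mono (mono p≤q) ⟩
      γ (ι q)   ≈⟨ γ′↾γ q ⟨
      ι (γ′ q)  ∎)

  restrict-inImage : ∀ {γ′ γ} → Restricts γ′ γ → ∀ {p} → InImage P γ′ p → InImage N γ (ι p)
  restrict-inImage γ′↾γ (m , p≈γ′m) = ι m , N≤.Eq.trans (ι-cong p≈γ′m) (γ′↾γ m)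

  restrict-preConucleus : ∀ {σ′ σ} → Restricts σ′ σ →
    IsPreConucleus N σ → IsPreConucleus P σ′
  restrict-preConucleus {σ′} {σ} σ′↾σ (σ-ii , σ-closed) =
    restrict-idempotentIsotone σ′↾σ σ-ii , closed
    where
    closed : ∀ p q → InImage P σ′ p → InImage P σ′ q → InImage P σ′ (p P.· q)
    closed p q p∈ q∈ = p P.· q , reflects-≈ (begin-equality
      ι (p P.· q)       ≈⟨ inImage⇒fixed σ-ii ιpq∈Nσ ⟩
      σ (ι (p P.· q))   ≈⟨ σ′↾σ (p P.· q) ⟨
      ι (σ′ (p P.· q))  ∎)
      where
      ιpq∈Nσ : InImage N σ (ι (p P.· q))
      ιpq∈Nσ with σ-closed (ι p) (ι q) (restrict-inImage σ′↾σ p∈) (restrict-inImage σ′↾σ q∈)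
      ... | m , ιp·ιq≈σm = m , N≤.Eq.trans (homo p q) ιp·ιq≈σm

  restrict-σStructural : ∀ {σ′ σ γ′ γ} → Restricts σ′ σ → Restricts γ′ γ →
    IsIdempotentIsotone N γ → IsσStructural N σ γ → IsσStructural P σ′ γ′
  restrict-σStructural {γ′ = γ′} {γ} σ′↾σ γ′↾γ (_ , γ-mono) structural a m a∈ =
    reflects (begin
      ι (a P.· γ′ m)      ≈⟨ homo a (γ′ m) ⟩
      ι a N.· ι (γ′ m)    ≤⟨ N.·-mono N≤.refl (N≤.reflexive (γ′↾γ m)) ⟩
      ι a N.· γ (ι m)     ≤⟨ proj₁ (structural (ι a) (ι m) ιa∈Nσ) ⟩
      γ (ι a N.· ι m)     ≤⟨ γ-mono (N≤.reflexive (N≤.Eq.sym (homo a m))) ⟩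
      γ (ι (a P.· m))     ≈⟨ γ′↾γ (a P.· m) ⟨
      ι (γ′ (a P.· m))    ∎) ,
    reflects (begin
      ι (γ′ m P.· a)      ≈⟨ homo (γ′ m) a ⟩
      ι (γ′ m) N.· ι a    ≤⟨ N.·-mono (N≤.reflexive (γ′↾γ m)) N≤.refl ⟩
      γ (ι m) N.· ι a     ≤⟨ proj₂ (structural (ι a) (ι m) ιa∈Nσ) ⟩
      γ (ι m N.· ι a)     ≤⟨ γ-mono (N≤.reflexive (N≤.Eq.sym (homo m a))) ⟩
      γ (ι (m P.· a))     ≈⟨ γ′↾γ (m P.· a) ⟨
      ι (γ′ (m P.· a))    ∎)
    where
    ιa∈Nσ = restrict-inImage σ′↾σ a∈

  restrict-σStructuralσClosure : ∀ {σ′ σ γ′ γ} → Restricts σ′ σ → Restricts γ′ γ →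
    IsσStructuralσClosure N σ γ → IsσStructuralσClosure P σ′ γ′
  restrict-σStructuralσClosure σ′↾σ γ′↾γ ((γ-ii , _) , structural) =
    PosemigroupProperties.σStructural⇒σClosure P γ′-ii structural′ , structural′
    where
    γ′-ii = restrict-idempotentIsotone γ′↾γ γ-ii
    structural′ = restrict-σStructural σ′↾σ γ′↾γ γ-ii structural

module NagataProperties {c ℓ} (B : ResiduatedBimodule c ℓ) (o : ResiduatedBimodule.M B) where
  open ResiduatedBimodule B
  open Nagata B o
  private
    module S≤ = IsPartialOrder S-po
    module M≤ = IsJoinSemilattice M-jsl
    M-joinSemilattice : JoinSemilattice c c ℓ
    M-joinSemilattice = record { isJoinSemilattice = M-jsl }
    open JoinSemilatticeProperties M-joinSemilattice using (∨-idempotent)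
    open PartialOrderReasoning (JoinSemilattice.poset M-joinSemilattice)

  ∖ʳ-greatest : ∀ {z a y} → z *ʳ a ≤M y → a ≤S z ∖ʳ y
  ∖ʳ-greatest {z} {a} {y} = Equivalence.to (resʳ₂ a z y)

  ∖ʳ-counit : ∀ z y → z *ʳ (z ∖ʳ y) ≤M y
  ∖ʳ-counit z y = Equivalence.from (resʳ₂ (z ∖ʳ y) z y) S≤.refl

  ∖ʳ-monoʳ : ∀ z {x y} → x ≤M y → z ∖ʳ x ≤S z ∖ʳ y
  ∖ʳ-monoʳ z {x} x≤y = ∖ʳ-greatest (M≤.trans (∖ʳ-counit z x) x≤y)

  ≤-γ : ∀ {a x y} → o *ʳ a ≤M y → x ≤M y → (a , x) ≤N (o ∖ʳ y , y)
  ≤-γ oa≤y x≤y = ∖ʳ-greatest oa≤y , x≤y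

  γ-idempotentIsotone : IsIdempotentIsotone NagataProduct γ
  γ-idempotentIsotone = (λ _ → ≡.refl) , λ (_ , x≤y) → ∖ʳ-monoʳ o x≤y , x≤y

  module _ (cyc : IsCyclicPoint B o) where

    σ-preConucleus : IsPreConucleus NagataProduct σ
    σ-preConucleus = ((λ _ → ≡.refl) , λ (a≤b , _) → a≤b , *ˡ-mono a≤b M≤.refl) , closed
      where
      closed : ∀ p q → InImage NagataProduct σ p → InImage NagataProduct σ q →
               InImage NagataProduct σ (p ∘N q)
      closed _ _ ((a , _) , ≡.refl) ((b , _) , ≡.refl) =
        (a · b , o) , cong (a · b ,_) (begin-equality
        (a *ˡ o) *ʳ b ∨ a *ˡ (b *ˡ o)  ≡⟨ cong (_∨ a *ˡ (b *ˡ o)) (*-bi a o b) ⟩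
        a *ˡ (o *ʳ b) ∨ a *ˡ (b *ˡ o)  ≡⟨ cong (λ z → a *ˡ z ∨ a *ˡ (b *ˡ o)) (cyc b) ⟨
        a *ˡ (b *ˡ o) ∨ a *ˡ (b *ˡ o)  ≡⟨ ∨-idempotent _ ⟩
        a *ˡ (b *ˡ o)                  ≡⟨ *ˡ-assoc a b o ⟨
        (a · b) *ˡ o                   ∎)

    γ-σStructural : IsσStructural NagataProduct σ γ
    γ-σStructural _ m@(_ , y) ((b , _) , ≡.refl) = left , right
      where
      a : S × M
      a = b , b *ˡ o

      w : S
      w = o ∖ʳ y

      bo·w≤by : (b *ˡ o) *ʳ w ≤M b *ˡ y
      bo·w≤by = begin
        (b *ˡ o) *ʳ w  ≡⟨ *-bi b o w ⟩
        b *ˡ (o *ʳ w)  ≤⟨ *ˡ-mono S≤.refl (∖ʳ-counit o y) ⟩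
        b *ˡ y         ∎

      w·bo≤yb : w *ˡ (b *ˡ o) ≤M y *ʳ b
      w·bo≤yb = begin
        w *ˡ (b *ˡ o)  ≡⟨ cong (w *ˡ_) (cyc b) ⟩
        w *ˡ (o *ʳ b)  ≡⟨ *-bi w o b ⟨
        (w *ˡ o) *ʳ b  ≡⟨ cong (_*ʳ b) (cyc w) ⟩
        (o *ʳ w) *ʳ b  ≤⟨ *ʳ-mono S≤.refl (∖ʳ-counit o y) ⟩
        y *ʳ b         ∎

      left : (a ∘N γ m) ≤N γ (a ∘N m)
      left = ≤-γ (begin
          o *ʳ (b · w)    ≡⟨ *ʳ-assoc o b w ⟩
          (o *ʳ b) *ʳ w   ≡⟨ cong (_*ʳ w) (cyc b) ⟨
          (b *ˡ o) *ʳ w   ≤⟨ bo·w≤by ⟩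
          b *ˡ y          ≤⟨ M≤.y≤x∨y _ _ ⟩
          _               ∎)
        (M≤.∨-least (M≤.trans bo·w≤by (M≤.y≤x∨y _ _)) (M≤.y≤x∨y _ _))

      right : (γ m ∘N a) ≤N γ (m ∘N a)
      right = ≤-γ (begin
          o *ʳ (w · b)    ≡⟨ *ʳ-assoc o w b ⟩
          (o *ʳ w) *ʳ b   ≤⟨ *ʳ-mono S≤.refl (∖ʳ-counit o y) ⟩
          y *ʳ b          ≤⟨ M≤.x≤x∨y _ _ ⟩
          _               ∎)
        (M≤.∨-least (M≤.x≤x∨y _ _) (M≤.trans w·bo≤yb (M≤.x≤x∨y _ _)))

    γ-σStructuralσClosure : IsσStructuralσClosure NagataProduct σ γ
    γ-σStructuralσClosure =
      PosemigroupProperties.σStructural⇒σClosure NagataProduct γ-idempotentIsotone γ-σStructural ,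
      γ-σStructural

    proj₁-embedding : IsOrderEmbeddingHomomorphism RestrictedNagataProduct NagataProduct proj₁
    proj₁-embedding = record { homo = λ _ _ → ≡.refl ; mono = λ p≤q → p≤q ; reflects = λ p≤q → p≤q }

    open Restriction proj₁-embedding

    restricted-σ-preConucleus : IsPreConucleus RestrictedNagataProduct (σ₀ cyc)
    restricted-σ-preConucleus = restrict-preConucleus {σ₀ cyc} {σ} (λ _ → ≡.refl) σ-preConucleus

    restricted-σStructuralσClosure :
      IsσStructuralσClosure RestrictedNagataProduct (σ₀ cyc) (γ₀ cyc)
    restricted-σStructuralσClosure =
      restrict-σStructuralσClosure {σ₀ cyc} {σ} {γ₀ cyc} {γ} (λ _ → ≡.refl) (λ _ → ≡.refl)
        γ-σStructuralσClosure

mainTheorem13 : ∀ {c ℓ : Level} (B : ResiduatedBimodule c ℓ) (o : ResiduatedBimodule.M B)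
    → (cyc : IsCyclicPoint B o)
    → let open Nagata B o in
      (IsPreConucleus NagataProduct σ
        × IsσStructuralσClosure NagataProduct σ γ)
      × (IsPreConucleus RestrictedNagataProduct (σ₀ cyc)
        × IsσStructuralσClosure RestrictedNagataProduct (σ₀ cyc) (γ₀ cyc))
mainTheorem13 B o cyc =
  (σ-preConucleus cyc , γ-σStructuralσClosure cyc) ,
  (restricted-σ-preConucleus cyc , restricted-σStructuralσClosure cyc)
  where open NagataProperties B o
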